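{- Let $L_n=P_n\square P_2$ be the ladder graph on $2n$ vertices, with its standard plane embedding (outer cycle $v_1,\dots,v_n,u_n,\dots,u_1$ and inner faces the quadrangles $v_iv_{i+1}u_{i+1}u_i$). Then $\pi_{fl}(L_n)\le 8$.
   Context: A sequence $r_1\dots r_{2n}$ is a repetition if $r_i=r_{n+i}$ for all $i\le n$. In a plane graph $G$, a facial path is a path whose vertices and edges are consecutive on the boundary walk of some face of $G$. A vertex colouring is facial non-repetitive if no facial path on vertices $v_1,\dots,v_{2n}$ ($n\ge1$) has colour sequence that is a repetition. $\pi_{fl}(G)$ is the minimum $l$ such that for every assignment of lists $L(v)\subseteq\mathbb{Z}_+$ with $|L(v)|\ge l$ there is a facial non-repetitive colouring $\varphi$ with $\varphi(v)\in L(v)$ for every vertex $v$. -}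

module Defs where

open import Data.Nat using (ℕ; suc; _+_; _≤_)
open import Data.Fin using (Fin; toℕ)
open import Data.Bool using (Bool; true; false)
open import Data.Product using (_×_; _,_; Σ; ∃; ∃-syntax)
open import Data.Sum using (_⊎_)
open import Data.List using (List; []; _∷_; _++_; map; reverse; length; take; drop; allFin)
open import Data.List.Relation.Unary.Unique.Propositional using (Unique)
open import Data.List.Membership.Propositional using (_∈_)
open import Relation.Binary.PropositionalEquality using (_≡_)
open import Relation.Nullary using (¬_)

-- Vertices of the ladder L_n = P_n □ P_2:
-- (i , true) is v_{i+1}, (i , false) is u_{i+1}.
Vertex : ℕ → Set
Vertex n = Fin n × Bool

data Face (n : ℕ) : Set where
  outer : Face n
  inner : (a b : Fin n) → toℕ b ≡ suc (toℕ a) → Face n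

boundary : {n : ℕ} → Face n → List (Vertex n)
boundary {n} outer =
  map (λ i → (i , true)) (allFin n) ++ reverse (map (λ i → (i , false)) (allFin n))
boundary (inner a b _) = (a , true) ∷ (b , true) ∷ (b , false) ∷ (a , false) ∷ []

Infix : {A : Set} → List A → List A → Set
Infix {A} xs ys = Σ (List A) λ pre → Σ (List A) λ suf → pre ++ xs ++ suf ≡ ys

-- A facial path: a path (distinct vertices) whose vertices are consecutive
-- on the (cyclic) boundary walk of some face, in either direction.
FacialPath : {n : ℕ} → List (Vertex n) → Set
FacialPath {n} w =
  Unique w ×
  Σ (Face n) λ F →
    Infix w (boundary F ++ boundary F) ⊎
    Infix w (reverse (boundary F ++ boundary F))

Repetition : List ℕ → Set
Repetition r = ∃[ k ] (1 ≤ k × length r ≡ k + k × take k r ≡ drop k r)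

FacialNonRepetitive : {n : ℕ} → (Vertex n → ℕ) → Set
FacialNonRepetitive {n} φ =
  (w : List (Vertex n)) → FacialPath w → ¬ Repetition (map φ w)

FacialListBound : ℕ → ℕ → Set
FacialListBound n l =
  (L : Vertex n → List ℕ) →
  ((v : Vertex n) → Unique (L v) × l ≤ length (L v)) →
  Σ (Vertex n → ℕ) λ φ → ((v : Vertex n) → φ v ∈ L v) × FacialNonRepetitive φ

-- Let n = m + 1, write v_i = (i , true) and u_i = (i , false) for 0 ≤ i ≤ m, and let x = u₀.
-- Give x any colour cx from its list. The other 2m + 1 vertices form the path v₀ … v_m u_m … u₁
-- of the outer cycle, and we colour it by a square-free word chosen from the lists whose letter
-- at each position also avoids at most four colours determined before it: cx, the previous
-- letter, and, at u_j, the colours of v_j and v_(j-1). With lists of size 4 + 4 such words exist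
-- in every length, since a counting argument shows that their number at least doubles with each
-- letter.
--
-- A facial path of the outer face either contains x, whose colour then occurs exactly once, or
-- is a subpath of the square-free path. A facial path of an inner face has at most four vertices,
-- and the avoided colours make that quadrangle properly coloured with distinct colours at the ends
-- of the diagonal v_(j-1) u_j, which excludes repetitions of length 2 and 4.

module Submission where

open import Defs
open import Data.Nat
  using (ℕ; zero; suc; _+_; _*_; _∸_; _^_; _≤_; _<_; z≤n; s≤s; s≤s⁻¹; _≤?_; _≟_)
open import Data.Nat.Properties
open import Data.Nat.ListAction using (sum)
open import Data.Nat.Tactic.RingSolver using (solve-∀)
open import Data.Fin using (Fin; zero; suc; toℕ; fromℕ<)
open import Data.Bool using (true; false)
import Data.Bool.Properties as Bool
import Data.Fin.Properties as Fin
import Data.Product.Properties as Product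
open import Data.Fin.Properties using (toℕ<n; toℕ-injective; toℕ-fromℕ<; fromℕ<-toℕ)
open import Data.List
  using (List; []; _∷_; _++_; [_]; map; length; take; drop; reverse; filter; concatMap; downFrom; tabulate; allFin)
open import Data.List.Properties
  using (length-++; length-map; length-reverse; length-take; ∷-injective; ++-assoc; ++-conicalˡ; ++-conicalʳ;
         map-++; map-cong; reverse-map; map-∘; map-tabulate; tabulate-cong; length-drop; take++drop≡id;
         reverse-++; reverse-involutive; unfold-reverse; ≡-dec)
open import Data.List.Relation.Unary.Any using (Any; here; there; any?)
open import Data.List.Relation.Unary.All as All using (All; []; _∷_)
open import Data.List.Relation.Binary.Disjoint.Propositional using (Disjoint)
import Data.List.Relation.Unary.AllPairs as AllPairs
import Data.List.Relation.Unary.AllPairs.Properties as AllPairs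
open import Data.List.Relation.Unary.Unique.Propositional using (Unique; []; _∷_)
import Data.List.Relation.Unary.Unique.Propositional.Properties as Unique
open import Data.List.Membership.Propositional using (_∈_; _∉_; find; lose)
open import Data.List.Membership.Propositional.Properties
  using (∈-∃++; ∈-++⁻; ∈-++⁺ˡ; ∈-++⁺ʳ; ∈-map⁺; ∈-map⁻; ∈-filter⁺; ∈-filter⁻;
         ∈-concatMap⁻; ∈-downFrom⁺)
open import Data.List.Membership.DecPropositional _≟_ using (_∈?_)
import Data.List.Membership.DecPropositional as DecMembership
open import Data.List.Relation.Unary.Any.Properties using (reverse⁻)
open import Data.Product using (Σ; _×_; _,_; proj₁; proj₂)
open import Data.Sum using (_⊎_; inj₁; inj₂; reduce)
open import Data.Empty using (⊥-elim)
open import Function using (_∘_; id)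
open import Relation.Nullary using (¬_; Dec; yes; no)
open import Relation.Nullary.Decidable using (_×-dec_; ¬?)
open import Relation.Unary using (Decidable)
open import Relation.Binary.Definitions using (DecidableEquality)
open import Relation.Binary.PropositionalEquality hiding ([_])

private
  variable
    A B : Set

-- Out-of-range indices read the junk value 0.
at : List ℕ → ℕ → ℕ
at []       _       = 0
at (x ∷ xs) zero    = x
at (x ∷ xs) (suc i) = at xs i

at-++ˡ : ∀ xs ys {i} → i < length xs → at (xs ++ ys) i ≡ at xs i
at-++ˡ (x ∷ xs) ys {zero}  _         = refl
at-++ˡ (x ∷ xs) ys {suc i} (s≤s i<n) = at-++ˡ xs ys i<n

at-++ʳ : ∀ xs ys i → at (xs ++ ys) (length xs + i) ≡ at ys i
at-++ʳ []       ys i = refl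
at-++ʳ (x ∷ xs) ys i = at-++ʳ xs ys i

at-take : ∀ n xs {i} → i < n → at (take n xs) i ≡ at xs i
at-take (suc n) []       _                 = refl
at-take (suc n) (x ∷ xs) {zero}  _         = refl
at-take (suc n) (x ∷ xs) {suc i} (s≤s i<n) = at-take n xs i<n

at-reverse : ∀ xs {i} → i < length xs → at (reverse xs) i ≡ at xs (length xs ∸ suc i)
at-reverse (x ∷ xs) {i} i<n rewrite unfold-reverse x xs with m≤n⇒m<n∨m≡n (s≤s⁻¹ i<n)
... | inj₁ i<len = begin
  at (reverse xs ++ [ x ]) i
    ≡⟨ at-++ˡ (reverse xs) [ x ] (subst (i <_) (sym (length-reverse xs)) i<len) ⟩
  at (reverse xs) i
    ≡⟨ at-reverse xs i<len ⟩
  at (x ∷ xs) (suc (length xs ∸ suc i))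
    ≡⟨ cong (at (x ∷ xs)) (+-∸-assoc 1 i<len) ⟨
  at (x ∷ xs) (length xs ∸ i)
    ∎
  where open ≡-Reasoning
... | inj₂ refl = begin
  at (reverse xs ++ [ x ]) (length xs)
    ≡⟨ cong (at (reverse xs ++ [ x ])) (trans (sym (length-reverse xs)) (sym (+-identityʳ _))) ⟩
  at (reverse xs ++ [ x ]) (length (reverse xs) + 0)
    ≡⟨ at-++ʳ (reverse xs) [ x ] 0 ⟩
  x
    ≡⟨ cong (at (x ∷ xs)) (n∸n≡0 (length xs)) ⟨
  at (x ∷ xs) (length xs ∸ length xs)
    ∎
  where open ≡-Reasoning

take-at-drop : ∀ xs {i} → i < length xs → take i xs ++ at xs i ∷ drop (suc i) xs ≡ xs
take-at-drop (x ∷ xs) {zero}  _         = refl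
take-at-drop (x ∷ xs) {suc i} (s≤s i<n) = cong (x ∷_) (take-at-drop xs i<n)

length-take-≤ : ∀ {n} (xs : List A) → n ≤ length xs → length (take n xs) ≡ n
length-take-≤ {n = n} xs n≤len = trans (length-take n xs) (m≤n⇒m⊓n≡m n≤len)

take-length-++ : (xs ys : List A) → take (length xs) (xs ++ ys) ≡ xs
take-length-++ []       ys = refl
take-length-++ (x ∷ xs) ys = cong (x ∷_) (take-length-++ xs ys)

drop-length-++ : (xs ys : List A) → drop (length xs) (xs ++ ys) ≡ ys
drop-length-++ []       ys = refl
drop-length-++ (x ∷ xs) ys = drop-length-++ xs ys

tabulate-at : ∀ n xs → n ≤ length xs → tabulate {n = n} (at xs ∘ toℕ) ≡ take n xs
tabulate-at zero    xs       _          = refl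
tabulate-at (suc n) (x ∷ xs) (s≤s n≤m)  = cong (x ∷_) (tabulate-at n xs n≤m)

Infix-map : ∀ (g : A → B) {xs ys} → Infix xs ys → Infix (map g xs) (map g ys)
Infix-map g {xs} {ys} (pre , suf , eq) = map g pre , map g suf , (begin
  map g pre ++ map g xs ++ map g suf ≡⟨ cong (map g pre ++_) (map-++ g xs suf) ⟨
  map g pre ++ map g (xs ++ suf)     ≡⟨ map-++ g pre (xs ++ suf) ⟨
  map g (pre ++ xs ++ suf)           ≡⟨ cong (map g) eq ⟩
  map g ys                           ∎)
  where open ≡-Reasoning

Infix-reverse : ∀ {xs ys : List A} → Infix xs ys → Infix (reverse xs) (reverse ys)
Infix-reverse {xs = xs} {ys} (pre , suf , eq) = reverse suf , reverse pre , (begin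
  reverse suf ++ reverse xs ++ reverse pre   ≡⟨ ++-assoc (reverse suf) (reverse xs) (reverse pre) ⟨
  (reverse suf ++ reverse xs) ++ reverse pre ≡⟨ cong (_++ reverse pre) (reverse-++ xs suf) ⟨
  reverse (xs ++ suf) ++ reverse pre         ≡⟨ reverse-++ pre (xs ++ suf) ⟨
  reverse (pre ++ xs ++ suf)                 ≡⟨ cong reverse eq ⟩
  reverse ys                                 ∎)
  where open ≡-Reasoning

∈-Infix : ∀ {x} {xs ys : List A} → Infix xs ys → x ∈ xs → x ∈ ys
∈-Infix (pre , suf , refl) x∈xs = ∈-++⁺ʳ pre (∈-++⁺ˡ x∈xs)

Infix-[] : {xs : List A} → Infix xs [] → xs ≡ []
Infix-[] {xs = xs} (pre , suf , eq) = ++-conicalˡ xs suf (++-conicalʳ pre _ eq)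

Infix-split : ∀ {y} xs ys {zs : List A} → y ∉ xs → Infix xs (ys ++ y ∷ zs) → Infix xs ys ⊎ Infix xs zs
Infix-split xs ys y∉xs ([] , suf , eq) = inj₁ ([] , prefix-before xs ys suf y∉xs eq)
  where
  prefix-before : ∀ {y} xs ys suf {zs} → y ∉ xs → xs ++ suf ≡ ys ++ y ∷ zs →
                  Σ (List _) λ suf′ → xs ++ suf′ ≡ ys
  prefix-before []       ys       suf y∉ eq = ys , refl
  prefix-before (x ∷ xs) []       suf y∉ eq = ⊥-elim (y∉ (here (sym (proj₁ (∷-injective eq)))))
  prefix-before (x ∷ xs) (z ∷ ys) suf y∉ eq with ∷-injective eq
  ... | refl , eq′ with prefix-before xs ys suf (y∉ ∘ there) eq′
  ...   | suf′ , e = suf′ , cong (x ∷_) e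
Infix-split xs []       y∉xs (_ ∷ pre , suf , eq) = inj₂ (pre , suf , proj₂ (∷-injective eq))
Infix-split xs (z ∷ ys) y∉xs (_ ∷ pre , suf , eq)
  with Infix-split xs ys y∉xs (pre , suf , proj₂ (∷-injective eq))
... | inj₁ (pre′ , suf′ , e) = inj₁ (z ∷ pre′ , suf′ , cong (z ∷_) e)
... | inj₂ i                 = inj₂ i

-- Squares

IsSquare : List A → Set
IsSquare {A} r = Σ (List A) λ u → u ≢ [] × u ++ u ≡ r

SquareFree : List A → Set
SquareFree w = ∀ {r} → Infix r w → ¬ IsSquare r

¬square-[] : ¬ IsSquare {A} []
¬square-[] (u , u≢[] , eq) = u≢[] (++-conicalˡ u u eq)

repetition⇒square : ∀ {r} → Repetition r → IsSquare r
repetition⇒square {r} (k , 1≤k , len , take≡drop) =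
  take k r , take≢[] , trans (cong (take k r ++_) take≡drop) (take++drop≡id k r)
  where
  take≢[] : take k r ≢ []
  take≢[] eq = <⇒≱ (≤-trans 1≤k (m≤m+n k k)) (≤-reflexive (trans (sym len) (cong length r≡[])))
    where
    r≡[] : r ≡ []
    r≡[] = trans (sym (take++drop≡id k r)) (cong₂ _++_ eq (trans (sym take≡drop) eq))

square-reverse : ∀ {r : List A} → IsSquare r → IsSquare (reverse r)
square-reverse (u , u≢[] , refl) =
  reverse u , (λ eq → u≢[] (trans (sym (reverse-involutive u)) (cong reverse eq))) , sym (reverse-++ u u)

squareFree-reverse : ∀ {w : List A} → SquareFree w → SquareFree (reverse w)
squareFree-reverse {w = w} sf {r} I sq =
  sf (subst (Infix (reverse r)) (reverse-involutive w) (Infix-reverse I)) (square-reverse sq)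

occurrences : ℕ → List ℕ → ℕ
occurrences c []       = 0
occurrences c (y ∷ ys) with c ≟ y
... | yes _ = suc (occurrences c ys)
... | no  _ = occurrences c ys

occurrences-++ : ∀ c xs ys → occurrences c (xs ++ ys) ≡ occurrences c xs + occurrences c ys
occurrences-++ c []       ys = refl
occurrences-++ c (y ∷ xs) ys with c ≟ y
... | yes _ = cong suc (occurrences-++ c xs ys)
... | no  _ = occurrences-++ c xs ys

n+n≢1 : ∀ n → n + n ≢ 1
n+n≢1 (suc n) eq = 1+n≢0 (trans (sym (+-suc n n)) (suc-injective eq))

occurrences≡1⇒¬square : ∀ {c r} → occurrences c r ≡ 1 → ¬ IsSquare r
occurrences≡1⇒¬square {c} once (u , _ , refl) = n+n≢1 (occurrences c u) (trans (sym (occurrences-++ c u u)) once)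

module _ (φ : A → ℕ) {x : A} (only-x : ∀ v → φ v ≡ φ x → v ≡ x) where

  occurrences-∉ : ∀ {w} → x ∉ w → occurrences (φ x) (map φ w) ≡ 0
  occurrences-∉ {[]}    _    = refl
  occurrences-∉ {v ∷ w} x∉vw with φ x ≟ φ v
  ... | yes e = ⊥-elim (x∉vw (here (sym (only-x v (sym e)))))
  ... | no  _ = occurrences-∉ (x∉vw ∘ there)

  occurrences-∈ : ∀ {w} → Unique w → x ∈ w → occurrences (φ x) (map φ w) ≡ 1
  occurrences-∈ {v ∷ w} (v∉w ∷ _) (here refl) with φ x ≟ φ x
  ... | yes _ = cong suc (occurrences-∉ (λ x∈w → All.lookup v∉w x∈w refl))
  ... | no ne = ⊥-elim (ne refl)
  occurrences-∈ {v ∷ w} (v∉w ∷ w-unique) (there x∈w) with φ x ≟ φ v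
  ... | yes e = ⊥-elim (All.lookup v∉w x∈w (only-x v (sym e)))
  ... | no  _ = occurrences-∈ w-unique x∈w

length-≤-⊆-unique : ∀ {xs ys : List A} → Unique xs → (∀ {x} → x ∈ xs → x ∈ ys) → length xs ≤ length ys
length-≤-⊆-unique {xs = []}     _              _  = z≤n
length-≤-⊆-unique {xs = x ∷ xs} {ys} (x∉xs ∷ xs-unique) xs⊆ys with ∈-∃++ (xs⊆ys (here refl))
... | us , vs , refl = begin
  suc (length xs)                ≤⟨ s≤s (length-≤-⊆-unique xs-unique xs⊆us++vs) ⟩
  suc (length (us ++ vs))        ≡⟨ cong suc (length-++ us) ⟩
  suc (length us + length vs)    ≡⟨ +-suc (length us) (length vs) ⟨
  length us + length (x ∷ vs)    ≡⟨ length-++ us ⟨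
  length (us ++ x ∷ vs)          ∎
  where
  open ≤-Reasoning
  xs⊆us++vs : ∀ {z} → z ∈ xs → z ∈ us ++ vs
  xs⊆us++vs {z} z∈xs with ∈-++⁻ us (xs⊆ys (there z∈xs))
  ... | inj₁ z∈us         = ∈-++⁺ˡ z∈us
  ... | inj₂ (here refl)  = ⊥-elim (All.lookup x∉xs z∈xs refl)
  ... | inj₂ (there z∈vs) = ∈-++⁺ʳ us z∈vs

-- Four-cycles

-- Rotating the cycle consumes the prefix, so the recursion is on pre.
4-cycle-squareFree : ∀ {a b c d : A} → a ≢ b → b ≢ c → c ≢ d → d ≢ a → ¬ (a ≡ c × b ≡ d) →
  ∀ pre u suf → u ≢ [] → length u ≤ 2 → pre ++ (u ++ u) ++ suf ≢ a ∷ b ∷ c ∷ d ∷ a ∷ b ∷ c ∷ d ∷ []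
4-cycle-squareFree ab bc cd da ac×bd []  []                  suf u≢[] _ _    = u≢[] refl
4-cycle-squareFree ab bc cd da ac×bd []  (_ ∷ [])            suf _    _ refl = ab refl
4-cycle-squareFree ab bc cd da ac×bd []  (_ ∷ _ ∷ [])        suf _    _ refl = ac×bd (refl , refl)
4-cycle-squareFree ab bc cd da ac×bd []  (_ ∷ _ ∷ _ ∷ _)     suf _    (s≤s (s≤s ()))
4-cycle-squareFree {a = a} {b = b} {c = c} {d = d} ab bc cd da ac×bd (_ ∷ pre) u suf u≢[] short eq =
  4-cycle-squareFree bc cd da ab (λ (bd , ca) → ac×bd (sym ca , bd)) pre u (suf ++ [ a ]) u≢[] short (begin
    pre ++ (u ++ u) ++ suf ++ [ a ]     ≡⟨ cong (pre ++_) (++-assoc (u ++ u) suf [ a ]) ⟨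
    pre ++ ((u ++ u) ++ suf) ++ [ a ]   ≡⟨ ++-assoc pre ((u ++ u) ++ suf) [ a ] ⟨
    (pre ++ (u ++ u) ++ suf) ++ [ a ]   ≡⟨ cong (_++ [ a ]) (proj₂ (∷-injective eq)) ⟩
    b ∷ c ∷ d ∷ a ∷ b ∷ c ∷ d ∷ a ∷ []  ∎)
  where open ≡-Reasoning

n+n≤4⇒n≤2 : ∀ {n} → n + n ≤ 4 → n ≤ 2
n+n≤4⇒n≤2 {n} n+n≤4 = *-cancelˡ-≤ 2 (subst (_≤ 4) (cong (n +_) (sym (+-identityʳ n))) n+n≤4)

module _ (φ : A → ℕ) where

  quadrangle-forward : ∀ {p q r s} → φ p ≢ φ q → φ q ≢ φ r → φ r ≢ φ s → φ s ≢ φ p →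
    ¬ (φ p ≡ φ r × φ q ≡ φ s) →
    ∀ {w} → Unique w → Infix w ((p ∷ q ∷ r ∷ s ∷ []) ++ (p ∷ q ∷ r ∷ s ∷ [])) → ¬ IsSquare (map φ w)
  quadrangle-forward {p} {q} {r} {s} pq qr rs sp diagonals {w} w-unique I (u , u≢[] , u++u≡) with Infix-map φ I
  ... | pre , suf , eq =
    4-cycle-squareFree pq qr rs sp diagonals pre u suf u≢[] (n+n≤4⇒n≤2 u+u≤4)
      (trans (cong (λ z → pre ++ z ++ suf) u++u≡) eq)
    where
    Q = p ∷ q ∷ r ∷ s ∷ []
    u+u≤4 : length u + length u ≤ 4
    u+u≤4 = begin
      length u + length u ≡⟨ length-++ u ⟨
      length (u ++ u)     ≡⟨ cong length u++u≡ ⟩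
      length (map φ w)    ≡⟨ length-map φ w ⟩
      length w            ≤⟨ length-≤-⊆-unique w-unique (λ v∈w → reduce (∈-++⁻ Q (∈-Infix I v∈w))) ⟩
      4                   ∎
      where open ≤-Reasoning

  quadrangle-nonRepetitive : ∀ {p q r s} → φ p ≢ φ q → φ q ≢ φ r → φ r ≢ φ s → φ s ≢ φ p →
    ¬ (φ p ≡ φ r × φ q ≡ φ s) →
    let Q = p ∷ q ∷ r ∷ s ∷ [] in
    ∀ {w} → Unique w → Infix w (Q ++ Q) ⊎ Infix w (reverse (Q ++ Q)) → ¬ IsSquare (map φ w)
  quadrangle-nonRepetitive pq qr rs sp diagonals w-unique (inj₁ I) = quadrangle-forward pq qr rs sp diagonals w-unique I
  quadrangle-nonRepetitive pq qr rs sp diagonals w-unique (inj₂ I) =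
    quadrangle-forward (rs ∘ sym) (qr ∘ sym) (pq ∘ sym) (sp ∘ sym) (λ (sq , rp) → diagonals (sym rp , sym sq))
      w-unique I

-- Cycles through a vertex of private colour

module _ (_≟A_ : DecidableEquality A) (φ : A → ℕ) (path : List A) (x : A)
         (only-x : ∀ v → φ v ≡ φ x → v ≡ x) (path-squareFree : SquareFree (map φ path)) where

  private
    C : List A
    C = path ++ [ x ]

  cycle-avoiding : ∀ {w} → x ∉ w → Infix w (C ++ C) → ¬ IsSquare (map φ w)
  cycle-avoiding {w} x∉w I sq with Infix-split w path x∉w (subst (Infix w) (++-assoc path [ x ] C) I)
  ... | inj₁ I-path = path-squareFree (Infix-map φ I-path) sq
  ... | inj₂ I-C with Infix-split w path x∉w I-C
  ...   | inj₁ I-path = path-squareFree (Infix-map φ I-path) sq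
  ...   | inj₂ I-[]   = ¬square-[] (subst (IsSquare ∘ map φ) (Infix-[] I-[]) sq)

  cycle-nonRepetitive : ∀ {w} → Unique w → Infix w (C ++ C) ⊎ Infix w (reverse (C ++ C)) → ¬ IsSquare (map φ w)
  cycle-nonRepetitive {w} w-unique I sq with DecMembership._∈?_ _≟A_ x w
  ... | yes x∈w = occurrences≡1⇒¬square (occurrences-∈ φ only-x w-unique x∈w) sq
  cycle-nonRepetitive w-unique (inj₁ I) sq | no x∉w = cycle-avoiding x∉w I sq
  cycle-nonRepetitive {w} w-unique (inj₂ I) sq | no x∉w =
    cycle-avoiding (x∉w ∘ reverse⁻) (subst (Infix (reverse w)) (reverse-involutive (C ++ C)) (Infix-reverse I))
      (subst IsSquare (sym (reverse-map φ w)) (square-reverse sq))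

-- Sums and double counting

indicator : {P : Set} → Dec P → ℕ
indicator (yes _) = 1
indicator (no  _) = 0

module _ {P : A → Set} (P? : Decidable P) where

  length-filter-∷ : ∀ x xs → length (filter P? (x ∷ xs)) ≡ indicator (P? x) + length (filter P? xs)
  length-filter-∷ x xs with P? x
  ... | yes _ = refl
  ... | no  _ = refl

  length-filter≡sum : ∀ xs → length (filter P? xs) ≡ sum (map (indicator ∘ P?) xs)
  length-filter≡sum []       = refl
  length-filter≡sum (x ∷ xs) = trans (length-filter-∷ x xs) (cong (indicator (P? x) +_) (length-filter≡sum xs))

  length-filter-partition : ∀ xs → length xs ≡ length (filter P? xs) + length (filter (¬? ∘ P?) xs)
  length-filter-partition []       = refl
  length-filter-partition (x ∷ xs) with P? x
  ... | yes _ = cong suc (length-filter-partition xs)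
  ... | no  _ = trans (cong suc (length-filter-partition xs)) (sym (+-suc _ _))

sum-map-+ : ∀ (g h : A → ℕ) xs → sum (map (λ x → g x + h x) xs) ≡ sum (map g xs) + sum (map h xs)
sum-map-+ g h []       = refl
sum-map-+ g h (x ∷ xs) = begin
  g x + h x + sum (map (λ x → g x + h x) xs)    ≡⟨ cong (g x + h x +_) (sum-map-+ g h xs) ⟩
  g x + h x + (sum (map g xs) + sum (map h xs)) ≡⟨ +-+-comm (g x) (h x) (sum (map g xs)) (sum (map h xs)) ⟩
  g x + sum (map g xs) + (h x + sum (map h xs)) ∎
  where
  open ≡-Reasoning
  +-+-comm : ∀ a b c d → a + b + (c + d) ≡ a + c + (b + d)
  +-+-comm = solve-∀

sum-map-0 : ∀ (xs : List A) → sum (map (λ _ → 0) xs) ≡ 0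
sum-map-0 []       = refl
sum-map-0 (x ∷ xs) = sum-map-0 xs

sum-map-mono : ∀ (g h : A → ℕ) xs → (∀ x → x ∈ xs → g x ≤ h x) → sum (map g xs) ≤ sum (map h xs)
sum-map-mono g h []       _   = z≤n
sum-map-mono g h (x ∷ xs) g≤h = +-mono-≤ (g≤h x (here refl)) (sum-map-mono g h xs (λ y → g≤h y ∘ there))

*-length≤sum-map : ∀ (g : A → ℕ) a xs → (∀ x → x ∈ xs → a ≤ g x) → a * length xs ≤ sum (map g xs)
*-length≤sum-map g a []       _   = ≤-reflexive (*-zeroʳ a)
*-length≤sum-map g a (x ∷ xs) a≤g = begin
  a * suc (length xs)   ≡⟨ *-suc a (length xs) ⟩
  a + a * length xs     ≤⟨ +-mono-≤ (a≤g x (here refl)) (*-length≤sum-map g a xs (λ y → a≤g y ∘ there)) ⟩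
  g x + sum (map g xs)  ∎
  where open ≤-Reasoning

double-counting : {R : A → B → Set} (R? : ∀ a b → Dec (R a b)) (as : List A) (bs : List B) →
  sum (map (λ a → length (filter (R? a) bs)) as) ≡ sum (map (λ b → length (filter (λ a → R? a b) as)) bs)
double-counting R? []       bs = sym (sum-map-0 bs)
double-counting R? (a ∷ as) bs = begin
  length (filter (R? a) bs) + sum (map (λ a → length (filter (R? a) bs)) as)
    ≡⟨ cong₂ _+_ (length-filter≡sum (R? a) bs) (double-counting R? as bs) ⟩
  sum (map (λ b → indicator (R? a b)) bs) + sum (map (λ b → length (filter (λ a → R? a b) as)) bs)
    ≡⟨ sum-map-+ (λ b → indicator (R? a b)) (λ b → length (filter (λ a → R? a b) as)) bs ⟨
  sum (map (λ b → indicator (R? a b) + length (filter (λ a → R? a b) as)) bs)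
    ≡⟨ cong sum (map-cong (λ b → sym (length-filter-∷ (λ a → R? a b) a as)) bs) ⟩
  sum (map (λ b → length (filter (λ a → R? a b) (a ∷ as))) bs) ∎
  where open ≡-Reasoning

geometric-bound : (g : ℕ → ℕ) (D l : ℕ) → (∀ k → k < l → 2 ^ k * g k ≤ D) →
  sum (map g (downFrom l)) ≤ 2 * D
geometric-bound g D l bound =
  *-cancelˡ-≤ (2 ^ l) {{m^n≢0 2 l}} (≤-trans (m+n≤o⇒m≤o _ (scaled l bound)) (≤-reflexive (*-comm-2 (2 ^ l) D)))
  where
  *-comm-2 : ∀ p d → 2 * p * d ≡ p * (2 * d)
  *-comm-2 = solve-∀
  -- The strengthened invariant 2^l · Σ_{k<l} g k + 2 D ≤ 2^(l+1) · D carries the induction.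
  scaled : ∀ l → (∀ k → k < l → 2 ^ k * g k ≤ D) → 2 ^ l * sum (map g (downFrom l)) + 2 * D ≤ 2 ^ suc l * D
  scaled zero    _     = ≤-reflexive (e0 D)
    where
    e0 : ∀ d → 1 * 0 + 2 * d ≡ 2 * 1 * d
    e0 = solve-∀
  scaled (suc l) bound = begin
    2 ^ suc l * (g l + S) + 2 * D                   ≡⟨ e1 (2 ^ l) (g l) S D ⟩
    2 * (2 ^ l * g l) + (2 * (2 ^ l * S) + 2 * D)   ≤⟨ +-monoˡ-≤ _ (*-monoʳ-≤ 2 (bound l ≤-refl)) ⟩
    2 * D + (2 * (2 ^ l * S) + 2 * D)               ≡⟨ e2 D (2 ^ l * S) ⟩
    2 * (2 ^ l * S + 2 * D)                         ≤⟨ *-monoʳ-≤ 2 (scaled l (λ k k<l → bound k (m≤n⇒m≤1+n k<l))) ⟩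
    2 * (2 ^ suc l * D)                             ≡⟨ *-assoc 2 (2 ^ suc l) D ⟨
    2 ^ suc (suc l) * D                             ∎
    where
    open ≤-Reasoning
    S = sum (map g (downFrom l))
    e1 : ∀ p a s d → 2 * p * (a + s) + 2 * d ≡ 2 * (p * a) + (2 * (p * s) + 2 * d)
    e1 = solve-∀
    e2 : ∀ d b → 2 * d + (2 * b + 2 * d) ≡ 2 * (b + 2 * d)
    e2 = solve-∀

SquarePrefix : ℕ → List ℕ → Set
SquarePrefix h z = h + h ≤ length z × take h z ≡ take h (drop h z)

squarePrefix? : ∀ h z → Dec (SquarePrefix h z)
squarePrefix? h z = (h + h ≤? length z) ×-dec ≡-dec _≟_ (take h z) (take h (drop h z))

squarePrefix-++ : ∀ u s → SquarePrefix (length u) ((u ++ u) ++ s)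
squarePrefix-++ u s rewrite ++-assoc u u s = long , (begin
    take (length u) (u ++ u ++ s)                       ≡⟨ take-length-++ u (u ++ s) ⟩
    u                                                   ≡⟨ take-length-++ u s ⟨
    take (length u) (u ++ s)                            ≡⟨ cong (take (length u)) (drop-length-++ u (u ++ s)) ⟨
    take (length u) (drop (length u) (u ++ u ++ s))     ∎)
  where
  open ≡-Reasoning
  long : length u + length u ≤ length (u ++ u ++ s)
  long = ≤-trans (+-monoʳ-≤ (length u) (m≤m+n (length u) (length s)))
                 (≤-reflexive (sym (trans (length-++ u) (cong (length u +_) (length-++ u)))))

drop-∷⇒at : ∀ k w {z zs} → drop k w ≡ z ∷ zs → at w k ≡ z
drop-∷⇒at zero    (x ∷ w) refl = refl
drop-∷⇒at (suc k) (x ∷ w) eq   = drop-∷⇒at k w eq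

squarePrefix-head : ∀ k y w → SquarePrefix (suc k) (y ∷ w) → y ≡ at w k
squarePrefix-head k y w (_ , eq) with drop k w in drop≡
squarePrefix-head k y w (_ , ())  | []
squarePrefix-head k y w (_ , eq)  | z ∷ zs = trans (proj₁ (∷-injective eq)) (sym (drop-∷⇒at k w drop≡))

-- Square-free choice from lists

module SquareFreeChoice (f : ℕ) (Lst : ℕ → List ℕ) (Lst-unique : ∀ l → Unique (Lst l))
    (Lst-large : ∀ l → f + 4 ≤ length (Lst l))
    (forb : ℕ → List ℕ → List ℕ) (forb-small : ∀ l pre → length (forb l pre) ≤ f) where

  -- Words are grown by prepending, so a word of length l lists its letters newest first;
  -- forb l sees the earlier letters in their natural order.
  StartsSquare : ℕ → List ℕ → Set
  StartsSquare y w = Any (λ k → SquarePrefix (suc k) (y ∷ w)) (downFrom (length w))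

  Admissible : ℕ → List ℕ → ℕ → Set
  Admissible l w y = y ∉ forb l (reverse w) × ¬ StartsSquare y w

  admissible? : ∀ l w → Decidable (Admissible l w)
  admissible? l w y =
    ¬? (y ∈? forb l (reverse w)) ×-dec ¬? (any? (λ k → squarePrefix? (suc k) (y ∷ w)) (downFrom (length w)))

  extensions : ℕ → List ℕ → List (List ℕ)
  extensions l w = map (_∷ w) (filter (admissible? l w) (Lst l))

  words : ℕ → List (List ℕ)
  words zero    = [ [] ]
  words (suc l) = concatMap (extensions l) (words l)

  #words : ℕ → ℕ
  #words l = length (words l)

  ∈-words-suc⁻ : ∀ {l v} → v ∈ words (suc l) →
    Σ ℕ λ y → Σ (List ℕ) λ w → v ≡ y ∷ w × w ∈ words l × y ∈ Lst l × Admissible l w y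
  ∈-words-suc⁻ {l} v∈ with find (∈-concatMap⁻ (extensions l) {xs = words l} v∈)
  ... | w , w∈ , v∈ext with ∈-map⁻ (_∷ w) v∈ext
  ...   | y , y∈ , refl with ∈-filter⁻ (admissible? l w) y∈
  ...     | y∈Lst , admissible = y , w , refl , w∈ , y∈Lst , admissible

  words-length : ∀ {l w} → w ∈ words l → length w ≡ l
  words-length {zero}  (here refl) = refl
  words-length {suc l} w∈ with ∈-words-suc⁻ {l} w∈
  ... | _ , _ , refl , w′∈ , _ = cong suc (words-length w′∈)

  words-drop : ∀ {l w} k → w ∈ words l → drop k w ∈ words (l ∸ k)
  words-drop           zero    w∈          = w∈
  words-drop {zero}    (suc k) (here refl) = here refl
  words-drop {suc l}   (suc k) w∈ with ∈-words-suc⁻ {l} w∈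
  ... | _ , _ , refl , w′∈ , _ = words-drop k w′∈

  words-unique : ∀ l → Unique (words l)
  words-unique zero    = [] ∷ []
  words-unique (suc l) = Unique.concat⁺ (all-unique (words l)) (AllPairs.map⁺ (AllPairs.map disjoint (words-unique l)))
    where
    all-unique : ∀ ws → All Unique (map (extensions l) ws)
    all-unique []       = []
    all-unique (w ∷ ws) =
      Unique.map⁺ (proj₁ ∘ ∷-injective) (Unique.filter⁺ (admissible? l w) (Lst-unique l)) ∷ all-unique ws
    disjoint : ∀ {w w′} → w ≢ w′ → Disjoint (extensions l w) (extensions l w′)
    disjoint {w} {w′} w≢w′ (v∈ , v∈′) with ∈-map⁻ (_∷ w) v∈ | ∈-map⁻ (_∷ w′) v∈′
    ... | _ , _ , refl | _ , _ , eq = w≢w′ (proj₂ (∷-injective eq))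

  #words-suc : ∀ l → #words (suc l) ≡ sum (map (λ w → length (filter (admissible? l w) (Lst l))) (words l))
  #words-suc l = go (words l)
    where
    go : ∀ ws → length (concatMap (extensions l) ws) ≡ sum (map (λ w → length (filter (admissible? l w) (Lst l))) ws)
    go []       = refl
    go (w ∷ ws) =
      trans (length-++ (extensions l w)) (cong₂ _+_ (length-map (_∷ w) (filter (admissible? l w) (Lst l))) (go ws))

  ClosesSquare : ℕ → List ℕ → Set
  ClosesSquare k w = SquarePrefix (suc k) (at w k ∷ w)

  closesSquare? : ∀ k w → Dec (ClosesSquare k w)
  closesSquare? k w = squarePrefix? (suc k) (at w k ∷ w)

  -- A rejected letter is forbidden, or it starts a square and then equals the letter k back.
  admissible+closing : ∀ l {w} → w ∈ words l →
    4 ≤ length (filter (admissible? l w) (Lst l)) + length (filter (λ k → closesSquare? k w) (downFrom l))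
  admissible+closing l {w} w∈ = +-cancelˡ-≤ f _ _ (begin
    f + 4                                 ≤⟨ Lst-large l ⟩
    length (Lst l)                        ≡⟨ length-filter-partition (admissible? l w) (Lst l) ⟩
    length Adm + length Rej               ≤⟨ +-monoʳ-≤ (length Adm) rejected-few ⟩
    length Adm + (f + length Closing)     ≡⟨ +-comm-middle (length Adm) f (length Closing) ⟩
    f + (length Adm + length Closing)     ∎)
    where
    open ≤-Reasoning
    Adm Rej Closing : List ℕ
    Adm     = filter (admissible? l w) (Lst l)
    Rej     = filter (¬? ∘ admissible? l w) (Lst l)
    Closing = filter (λ k → closesSquare? k w) (downFrom l)
    +-comm-middle : ∀ a b c → a + (b + c) ≡ b + (a + c)
    +-comm-middle = solve-∀
    rejected⊆ : ∀ {y} → y ∈ Rej → y ∈ forb l (reverse w) ++ map (at w) Closing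
    rejected⊆ {y} y∈Rej with proj₂ (∈-filter⁻ (¬? ∘ admissible? l w) {xs = Lst l} y∈Rej) | y ∈? forb l (reverse w)
    ... | _            | yes y∈forb = ∈-++⁺ˡ y∈forb
    ... | inadmissible | no  y∉forb with any? (λ k → squarePrefix? (suc k) (y ∷ w)) (downFrom (length w))
    ...   | no  ¬square = ⊥-elim (inadmissible (y∉forb , ¬square))
    ...   | yes square with find square
    ...     | k , k∈ , prefix with squarePrefix-head k y w prefix
    ...       | refl = ∈-++⁺ʳ (forb l (reverse w)) (∈-map⁺ (at w)
                         (∈-filter⁺ (λ k → closesSquare? k w) {xs = downFrom l}
                           (subst (λ n → k ∈ downFrom n) (words-length w∈) k∈) prefix))
    rejected-few : length Rej ≤ f + length Closing
    rejected-few = begin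
      length Rej                                  ≤⟨ length-≤-⊆-unique (Unique.filter⁺ _ (Lst-unique l)) rejected⊆ ⟩
      length (F ++ map (at w) Closing)            ≡⟨ length-++ F ⟩
      length F + length (map (at w) Closing)      ≡⟨ cong (length F +_) (length-map (at w) Closing) ⟩
      length F + length Closing                   ≤⟨ +-monoˡ-≤ _ (forb-small l (reverse w)) ⟩
      f + length Closing                          ∎
      where
      F = forb l (reverse w)

  -- Closing a square of half-length k + 1 makes the first k letters repeat the next ones,
  -- so the word is determined by its suffix of length l ∸ k.
  closing-few : ∀ l k → length (filter (closesSquare? k) (words l)) ≤ #words (l ∸ k)
  closing-few l k = ≤-trans (length-≤-⊆-unique (Unique.filter⁺ (closesSquare? k) (words-unique l)) closing⊆)
                            (≤-reflexive (length-map rebuild (words (l ∸ k))))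
    where
    rebuild : List ℕ → List ℕ
    rebuild v = drop 1 (take (suc k) v ++ v)
    closing⊆ : ∀ {w} → w ∈ filter (closesSquare? k) (words l) → w ∈ map rebuild (words (l ∸ k))
    closing⊆ {w} w∈ with ∈-filter⁻ (closesSquare? k) {xs = words l} w∈
    ... | w∈words , (_ , repeat) =
      subst (_∈ map rebuild (words (l ∸ k))) (sym w≡) (∈-map⁺ rebuild (words-drop k w∈words))
      where
      w≡ : w ≡ rebuild (drop k w)
      w≡ = cong (drop 1) (trans (sym (take++drop≡id (suc k) (at w k ∷ w))) (cong (_++ drop k w) repeat))

  Decay : ℕ → Set
  Decay l = ∀ k → k ≤ l → 2 ^ k * #words (l ∸ k) ≤ #words l

  -- Counting pairs (w , y) gives #words (suc l) ≥ 4 #words l − Σₖ #words (l ∸ k) ≥ 2 #words l.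
  doubling : ∀ l → Decay l → 2 * #words l ≤ #words (suc l)
  doubling l decay = +-cancelʳ-≤ (2 * #words l) _ _ (begin
    2 * #words l + 2 * #words l
      ≡⟨ double-double (#words l) ⟩
    4 * #words l
      ≤⟨ *-length≤sum-map (λ w → #adm w + #closing w) 4 (words l) (λ _ → admissible+closing l) ⟩
    sum (map (λ w → #adm w + #closing w) (words l))
      ≡⟨ sum-map-+ #adm #closing (words l) ⟩
    sum (map #adm (words l)) + sum (map #closing (words l))
      ≡⟨ cong (_+ sum (map #closing (words l))) (#words-suc l) ⟨
    #words (suc l) + sum (map #closing (words l))
      ≤⟨ +-monoʳ-≤ (#words (suc l)) closing-total ⟩
    #words (suc l) + 2 * #words l
      ∎)
    where
    open ≤-Reasoning
    #adm #closing : List ℕ → ℕ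
    #adm w     = length (filter (admissible? l w) (Lst l))
    #closing w = length (filter (λ k → closesSquare? k w) (downFrom l))
    double-double : ∀ c → 2 * c + 2 * c ≡ 4 * c
    double-double = solve-∀
    closing-total : sum (map #closing (words l)) ≤ 2 * #words l
    closing-total = begin
      sum (map #closing (words l))
        ≡⟨ double-counting (λ w k → closesSquare? k w) (words l) (downFrom l) ⟩
      sum (map (λ k → length (filter (closesSquare? k) (words l))) (downFrom l))
        ≤⟨ sum-map-mono _ (λ k → #words (l ∸ k)) (downFrom l) (λ k _ → closing-few l k) ⟩
      sum (map (λ k → #words (l ∸ k)) (downFrom l))
        ≤⟨ geometric-bound (λ k → #words (l ∸ k)) (#words l) l (λ k k<l → decay k (<⇒≤ k<l)) ⟩
      2 * #words l
        ∎

  decay : ∀ l → Decay l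
  decay zero    zero    z≤n       = ≤-reflexive (*-identityˡ _)
  decay (suc l) zero    _         = ≤-reflexive (*-identityˡ _)
  decay (suc l) (suc k) (s≤s k≤l) =
    ≤-trans (≤-reflexive (*-assoc 2 (2 ^ k) _)) (≤-trans (*-monoʳ-≤ 2 (decay l k k≤l)) (doubling l (decay l)))

  #words-positive : ∀ l → 1 ≤ #words l
  #words-positive zero    = s≤s z≤n
  #words-positive (suc l) =
    ≤-trans (#words-positive l) (≤-trans (m≤m+n (#words l) (#words l + 0)) (doubling l (decay l)))

  some-word : ∀ l → Σ (List ℕ) (_∈ words l)
  some-word l with words l | #words-positive l
  ... | w ∷ _ | _ = w , here refl

  words-squareFree : ∀ {l w} → w ∈ words l → SquareFree w
  words-squareFree {zero}  (here refl) I sq = ¬square-[] (subst IsSquare (Infix-[] I) sq)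
  words-squareFree {suc l} w∈ I sq with ∈-words-suc⁻ {l} w∈
  words-squareFree {suc l} w∈ (_ ∷ pre , suf , eq) sq | _ , _ , refl , w′∈ , _ =
    words-squareFree {l} w′∈ (pre , suf , proj₂ (∷-injective eq)) sq
  words-squareFree {suc l} w∈ ([] , suf , eq) ([] , u≢[] , _) | _ = u≢[] refl
  words-squareFree {suc l} w∈ ([] , suf , refl) (c ∷ u , _ , refl) | _ , _ , refl , _ , _ , _ , no-square =
    no-square (lose (∈-downFrom⁺ shorter) (squarePrefix-++ (c ∷ u) suf))
    where
    shorter : length u < length ((u ++ c ∷ u) ++ suf)
    shorter = begin-strict
      length u                           <⟨ m<m+n (length u) (s≤s z≤n) ⟩
      length u + length (c ∷ u)          ≡⟨ length-++ u ⟨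
      length (u ++ c ∷ u)                ≤⟨ m≤m+n _ (length suf) ⟩
      length (u ++ c ∷ u) + length suf   ≡⟨ length-++ (u ++ c ∷ u) ⟨
      length ((u ++ c ∷ u) ++ suf)       ∎
      where open ≤-Reasoning

  words-split : ∀ {l w} → w ∈ words l → ∀ pre y s → pre ++ y ∷ s ≡ w →
    y ∈ Lst (length s) × Admissible (length s) s y
  words-split {zero}  (here refl) []        y s ()
  words-split {zero}  (here refl) (_ ∷ pre) y s ()
  words-split {suc l} w∈ pre y s eq with ∈-words-suc⁻ {l} w∈
  words-split {suc l} w∈ []        y s refl | _ , _ , refl , w′∈ , y∈ , admissible =
    subst (λ n → y ∈ Lst n × Admissible n s y) (sym (words-length {l} w′∈)) (y∈ , admissible)
  words-split {suc l} w∈ (_ ∷ pre) y s eq   | _ , _ , refl , w′∈ , _ =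
    words-split {l} w′∈ pre y s (proj₂ (∷-injective eq))

  squareFree-choice : ∀ N → Σ (List ℕ) λ c → length c ≡ N × SquareFree c ×
    (∀ pre y suf → pre ++ y ∷ suf ≡ c → y ∈ Lst (length pre) × y ∉ forb (length pre) pre)
  squareFree-choice N =
    reverse w , trans (length-reverse w) (words-length {N} w∈) , squareFree-reverse (words-squareFree {N} w∈) , choice
    where
    w = proj₁ (some-word N)
    w∈ = proj₂ (some-word N)
    choice : ∀ pre y suf → pre ++ y ∷ suf ≡ reverse w → y ∈ Lst (length pre) × y ∉ forb (length pre) pre
    choice pre y suf eq with words-split {N} w∈ (reverse suf) y (reverse pre) w≡
      where
      w≡ : reverse suf ++ y ∷ reverse pre ≡ w
      w≡ = begin
        reverse suf ++ y ∷ reverse pre        ≡⟨ ++-assoc (reverse suf) [ y ] (reverse pre) ⟨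
        (reverse suf ++ [ y ]) ++ reverse pre ≡⟨ cong (_++ reverse pre) (unfold-reverse y suf) ⟨
        reverse (y ∷ suf) ++ reverse pre      ≡⟨ reverse-++ pre (y ∷ suf) ⟨
        reverse (pre ++ y ∷ suf)              ≡⟨ cong reverse eq ⟩
        reverse (reverse w)                   ≡⟨ reverse-involutive w ⟩
        w                                     ∎
        where open ≡-Reasoning
    ... | y∈ , y∉forb , _ rewrite length-reverse pre | reverse-involutive pre = y∈ , y∉forb

-- The ladder

suc-∸-∸ : ∀ {n i} → i ≤ n → suc n ∸ (n ∸ i) ≡ suc i
suc-∸-∸ {n} {i} i≤n = trans (+-∸-assoc 1 (m∸n≤m n i)) (cong suc (m∸[m∸n]≡n i≤n))

m<m+m∸n : ∀ {m n} → n < m → m < m + m ∸ n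
m<m+m∸n {m} {n} n<m = begin-strict
  m            <⟨ m<m+n m (m<n⇒0<n∸m n<m) ⟩
  m + (m ∸ n)  ≡⟨ +-∸-assoc m (<⇒≤ n<m) ⟨
  m + m ∸ n    ∎
  where open ≤-Reasoning

facialListBound-0 : ∀ l → FacialListBound 0 l
facialListBound-0 l L _ = (λ ()) , (λ ()) , λ where
  []            _ (suc k , _ , () , _)
  ((() , _) ∷ _) _ _

module Ladder (m : ℕ) (L : Vertex (suc m) → List ℕ)
    (L-ok : (v : Vertex (suc m)) → Unique (L v) × 8 ≤ length (L v)) where

  N : ℕ
  N = suc (m + m)

  x : Vertex (suc m)
  x = zero , false

  cx∈Lx : Σ ℕ (_∈ L x)
  cx∈Lx with L x | proj₂ (L-ok x)
  ... | c ∷ _ | _ = c , here refl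

  cx : ℕ
  cx = proj₁ cx∈Lx

  -- Positions 0 … 2m run along the path v₀ … v_m u_m … u₁.
  vertexAt : ℕ → Vertex (suc m)
  vertexAt p with p ≤? m
  ... | yes p≤m = fromℕ< (s≤s p≤m) , true
  ... | no  p≰m = fromℕ< (s≤s (≤-trans (∸-monoʳ-≤ N (≰⇒> p≰m)) (≤-reflexive (m+n∸m≡n m m)))) , false

  vertexAt-v : (i : Fin (suc m)) → vertexAt (toℕ i) ≡ (i , true)
  vertexAt-v i with toℕ i ≤? m
  ... | yes _   = cong (_, true) (fromℕ<-toℕ i _)
  ... | no  i≰m = ⊥-elim (i≰m (s≤s⁻¹ (toℕ<n i)))

  vertexAt-u : (i : Fin m) → vertexAt (m + m ∸ toℕ i) ≡ (suc i , false)
  vertexAt-u i with m + m ∸ toℕ i ≤? m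
  ... | yes ≤m = ⊥-elim (<⇒≱ (m<m+m∸n (toℕ<n i)) ≤m)
  ... | no  _  =
    cong (_, false) (toℕ-injective (trans (toℕ-fromℕ< _) (suc-∸-∸ (≤-trans (<⇒≤ (toℕ<n i)) (m≤m+n m m)))))

  -- At the position p of u_j, the positions N ∸ p and m + m ∸ p are those of v_j and v_(j-1);
  -- at the positions of the v_i they are out of range and read junk.
  forbidden : ℕ → List ℕ → List ℕ
  forbidden p pre = cx ∷ at pre (p ∸ 1) ∷ at pre (N ∸ p) ∷ at pre (m + m ∸ p) ∷ []

  open SquareFreeChoice 4 (L ∘ vertexAt) (proj₁ ∘ L-ok ∘ vertexAt) (proj₂ ∘ L-ok ∘ vertexAt)
                         forbidden (λ _ _ → ≤-refl)
    using (squareFree-choice)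

  c : List ℕ
  c = proj₁ (squareFree-choice N)

  c-length : length c ≡ N
  c-length = proj₁ (proj₂ (squareFree-choice N))

  c-squareFree : SquareFree c
  c-squareFree = proj₁ (proj₂ (proj₂ (squareFree-choice N)))

  allowed : ∀ {p} → p < N → at c p ∈ L (vertexAt p) × at c p ∉ forbidden p (take p c)
  allowed {p} p<N =
    subst (λ q → at c p ∈ L (vertexAt q) × at c p ∉ forbidden q (take p c)) (length-take-≤ c (<⇒≤ p<c))
      (proj₂ (proj₂ (proj₂ (squareFree-choice N))) (take p c) (at c p) (drop (suc p) c) (take-at-drop c p<c))
    where
    p<c : p < length c
    p<c = subst (p <_) (sym c-length) p<N

  ≢cx : ∀ {p} → p < N → at c p ≢ cx
  ≢cx p<N eq = proj₂ (allowed p<N) (here eq)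

  ≢previous : ∀ {p} → suc p < N → at c (suc p) ≢ at c p
  ≢previous {p} p<N eq = proj₂ (allowed p<N) (there (here (trans eq (sym (at-take (suc p) c ≤-refl)))))

  ≢rung : ∀ {p} → p < N → N ∸ p < p → at c p ≢ at c (N ∸ p)
  ≢rung p<N q<p eq = proj₂ (allowed p<N) (there (there (here (trans eq (sym (at-take _ c q<p))))))

  ≢diagonal : ∀ {p} → p < N → m + m ∸ p < p → at c p ≢ at c (m + m ∸ p)
  ≢diagonal p<N q<p eq = proj₂ (allowed p<N) (there (there (there (here (trans eq (sym (at-take _ c q<p)))))))

  v<N : ∀ {i} → i ≤ m → i < N
  v<N i≤m = s≤s (≤-trans i≤m (m≤m+n m m))

  u<N : ∀ i → m + m ∸ i < N
  u<N i = s≤s (m∸n≤m (m + m) i)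

  v-edge : ∀ {i} → i < m → at c i ≢ at c (suc i)
  v-edge i<m = ≢previous (v<N i<m) ∘ sym

  rung : ∀ {i} → i < m → at c (suc i) ≢ at c (m + m ∸ i)
  rung {i} i<m eq = ≢rung (u<N i) (subst (_< m + m ∸ i) (sym mirror) (≤-<-trans i<m (m<m+m∸n i<m)))
                      (trans (sym eq) (cong (at c) (sym mirror)))
    where
    mirror : N ∸ (m + m ∸ i) ≡ suc i
    mirror = suc-∸-∸ (≤-trans (<⇒≤ i<m) (m≤m+n m m))

  diagonal : ∀ {i} → i < m → at c i ≢ at c (m + m ∸ i)
  diagonal {i} i<m eq = ≢diagonal (u<N i) (subst (_< m + m ∸ i) (sym mirror) (<-trans i<m (m<m+m∸n i<m)))
                          (trans (sym eq) (cong (at c) (sym mirror)))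
    where
    mirror : m + m ∸ (m + m ∸ i) ≡ i
    mirror = m∸[m∸n]≡n (≤-trans (<⇒≤ i<m) (m≤m+n m m))

  u-edge : ∀ {i} → suc i < m → at c (m + m ∸ suc i) ≢ at c (m + m ∸ i)
  u-edge {i} i<m eq = ≢previous (subst (_< N) predecessor (u<N i)) (trans (cong (at c) (sym predecessor)) (sym eq))
    where
    predecessor : m + m ∸ i ≡ suc (m + m ∸ suc i)
    predecessor = +-∸-assoc 1 (≤-trans (<⇒≤ i<m) (m≤m+n m m))

  φ : Vertex (suc m) → ℕ
  φ (i     , true)  = at c (toℕ i)
  φ (zero  , false) = cx
  φ (suc i , false) = at c (m + m ∸ toℕ i)

  φ-allowed : ∀ v → φ v ∈ L v
  φ-allowed (i , true) =
    subst (λ v → φ (i , true) ∈ L v) (vertexAt-v i) (proj₁ (allowed (v<N (s≤s⁻¹ (toℕ<n i)))))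
  φ-allowed (zero , false) = proj₂ cx∈Lx
  φ-allowed (suc i , false) =
    subst (λ v → φ (suc i , false) ∈ L v) (vertexAt-u i) (proj₁ (allowed (u<N (toℕ i))))

  only-x : ∀ v → φ v ≡ cx → v ≡ x
  only-x (i     , true)  eq = ⊥-elim (≢cx (v<N (s≤s⁻¹ (toℕ<n i))) eq)
  only-x (zero  , false) _  = refl
  only-x (suc i , false) eq = ⊥-elim (≢cx (u<N (toℕ i)) eq)

  u-side : (a : Fin (suc m)) (b : Fin m) → toℕ b ≡ toℕ a →
    φ (suc b , false) ≢ φ (a , false) × φ (a , false) ≢ φ (a , true)
  u-side zero    b _   = ≢cx (u<N (toℕ b)) , ≢cx (v<N z≤n) ∘ sym
  u-side (suc a) b b≡a =
    subst (λ j → at c (m + m ∸ j) ≢ at c (m + m ∸ toℕ a)) (sym b≡a) (u-edge a<m) , rung (<-trans (n<1+n _) a<m) ∘ sym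
    where
    a<m : suc (toℕ a) < m
    a<m = subst (_< m) b≡a (toℕ<n b)

  inner-face : (a : Fin (suc m)) (b : Fin m) → toℕ b ≡ toℕ a → ∀ {w} → Unique w →
    let F = (a , true) ∷ (suc b , true) ∷ (suc b , false) ∷ (a , false) ∷ [] in
    Infix w (F ++ F) ⊎ Infix w (reverse (F ++ F)) → ¬ IsSquare (map φ w)
  inner-face a b b≡a = quadrangle-nonRepetitive φ
    (subst (λ j → at c j ≢ at c (suc (toℕ b))) b≡a (v-edge (toℕ<n b)))
    (rung (toℕ<n b))
    (proj₁ (u-side a b b≡a))
    (proj₂ (u-side a b b≡a))
    (λ (eq , _) → diagonal (toℕ<n b) (trans (cong (at c) b≡a) eq))

  vs us path : List (Vertex (suc m))
  vs   = map (_, true) (allFin (suc m))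
  us   = tabulate (λ i → suc i , false)
  path = vs ++ reverse us

  boundary-outer : boundary outer ≡ path ++ [ x ]
  boundary-outer = begin
    vs ++ reverse (x ∷ map (_, false) (tabulate suc))
      ≡⟨ cong (λ zs → vs ++ reverse (x ∷ zs)) (map-tabulate suc (_, false)) ⟩
    vs ++ reverse (x ∷ us)
      ≡⟨ cong (vs ++_) (unfold-reverse x us) ⟩
    vs ++ reverse us ++ [ x ]
      ≡⟨ ++-assoc vs (reverse us) [ x ] ⟨
    path ++ [ x ]
      ∎
    where open ≡-Reasoning

  map-φ-path : map φ path ≡ c
  map-φ-path = begin
    map φ path                                 ≡⟨ map-++ φ vs (reverse us) ⟩
    map φ vs ++ map φ (reverse us)             ≡⟨ cong₂ _++_ map-φ-vs (reverse-map φ us) ⟩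
    take (suc m) c ++ reverse (map φ us)       ≡⟨ cong (λ zs → take (suc m) c ++ reverse zs) map-φ-us ⟩
    take (suc m) c ++ reverse (take m (reverse c)) ≡⟨ cong (take (suc m) c ++_) reverse-take-reverse ⟩
    take (suc m) c ++ drop (suc m) c           ≡⟨ take++drop≡id (suc m) c ⟩
    c                                          ∎
    where
    open ≡-Reasoning
    map-φ-vs : map φ vs ≡ take (suc m) c
    map-φ-vs = trans (sym (map-∘ (allFin (suc m)))) (trans (map-tabulate id (φ ∘ (_, true)))
                 (tabulate-at (suc m) c (subst (suc m ≤_) (sym c-length) (s≤s (m≤m+n m m)))))
    map-φ-us : map φ us ≡ take m (reverse c)
    map-φ-us = begin
      map φ us                                  ≡⟨ map-tabulate (λ i → suc i , false) φ ⟩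
      tabulate (λ i → at c (m + m ∸ toℕ i))     ≡⟨ tabulate-cong (λ i → sym (u-from-end i)) ⟩
      tabulate (at (reverse c) ∘ toℕ)           ≡⟨ tabulate-at m (reverse c) m≤ ⟩
      take m (reverse c)                        ∎
      where
      m≤ : m ≤ length (reverse c)
      m≤ = subst (m ≤_) (sym (trans (length-reverse c) c-length)) (≤-trans (m≤m+n m m) (n≤1+n _))
      u-from-end : (i : Fin m) → at (reverse c) (toℕ i) ≡ at c (m + m ∸ toℕ i)
      u-from-end i =
        trans (at-reverse c (subst (toℕ i <_) (sym c-length) (≤-trans (toℕ<n i) (≤-trans (m≤m+n m m) (n≤1+n _)))))
              (cong (λ n → at c (n ∸ suc (toℕ i))) c-length)
    reverse-take-reverse : reverse (take m (reverse c)) ≡ drop (suc m) c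
    reverse-take-reverse = begin
      reverse (take m (reverse c))
        ≡⟨ cong (λ zs → reverse (take m (reverse zs))) (take++drop≡id (suc m) c) ⟨
      reverse (take m (reverse (front ++ back)))
        ≡⟨ cong (λ zs → reverse (take m zs)) (reverse-++ front back) ⟩
      reverse (take m (reverse back ++ reverse front))
        ≡⟨ cong (λ n → reverse (take n (reverse back ++ reverse front))) length-back ⟨
      reverse (take (length (reverse back)) (reverse back ++ reverse front))
        ≡⟨ cong reverse (take-length-++ (reverse back) (reverse front)) ⟩
      reverse (reverse back)
        ≡⟨ reverse-involutive back ⟩
      back
        ∎
      where
      front back : List ℕ
      front = take (suc m) c
      back  = drop (suc m) c
      length-back : length (reverse back) ≡ m
      length-back = trans (length-reverse back)
                          (trans (length-drop (suc m) c) (trans (cong (_∸ suc m) c-length) (m+n∸m≡n m m)))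

  _≟V_ : DecidableEquality (Vertex (suc m))
  _≟V_ = Product.≡-dec Fin._≟_ Bool._≟_

  nonRepetitive : FacialNonRepetitive φ
  nonRepetitive w (w-unique , outer , I) rep =
    cycle-nonRepetitive _≟V_ φ path x only-x (subst SquareFree (sym map-φ-path) c-squareFree) w-unique
      (subst (λ B → Infix w (B ++ B) ⊎ Infix w (reverse (B ++ B))) boundary-outer I) (repetition⇒square rep)
  nonRepetitive w (w-unique , inner a (suc b) e , I) rep =
    inner-face a b (suc-injective e) w-unique I (repetition⇒square rep)

theorem9 : (n : ℕ) → FacialListBound n 8
theorem9 zero    = facialListBound-0 8
theorem9 (suc m) L L-ok = Ladder.φ m L L-ok , Ladder.φ-allowed m L L-ok , Ladder.nonRepetitive m L L-ok
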